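{- Let $k \ge 3$ and let $B$ be a non-empty finite word over $\mathbb{N}$ that is a factor of $\mathbf{W}^{(k)}$. (a) The shifted word $k \oplus B$ is again a factor of $\mathbf{W}^{(k)}$. (b) Suppose in addition that for every $n \ge k$, every occurrence of $k \oplus B$ in $W_n^{(k)}$ is included, i.e. lies entirely inside one of the $k$ blocks $W_{n-1}^{(k)}, W_{n-2}^{(k)}, \dots, W_{n-k+1}^{(k)}, k \oplus W_{n-k}^{(k)}$ of the decomposition $W_n^{(k)} = W_{n-1}^{(k)} W_{n-2}^{(k)} \cdots W_{n-k+1}^{(k)} (k \oplus W_{n-k}^{(k)})$ (equivalently, no occurrence of $k\oplus B$ overlaps two consecutive blocks). Then, as formal power series, \[ C_{k \oplus B}^{(k)}(y) = y^k\, H_{k-1}(y)\, C_B^{(k)}(y). \]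
   Context: Words are over the alphabet $\mathbb{N}=\{0,1,2,\dots\}$ (letters called digits). For $k\ge 2$, $\phi_k:\mathbb{N}^*\to\mathbb{N}^*$ is the morphism defined for $i\in\mathbb{N}$, $0\le j\le k-1$ by $\phi_k(ki+j)=(ki)(ki+j+1)$ if $0\le j\le k-2$ and $\phi_k(ki+k-1)=ki+k$ (juxtaposition is concatenation). Set $W_n^{(k)}=\phi_k^n(0)$ and $\mathbf{W}^{(k)}=\lim_n \phi_k^n(0)$, the infinite fixed point; each $W_n^{(k)}$ is a prefix of $\mathbf{W}^{(k)}$. It is known that for $n\ge k$, $W_n^{(k)} = W_{n-1}^{(k)} W_{n-2}^{(k)} \cdots W_{n-k+1}^{(k)} (k \oplus W_{n-k}^{(k)})$. For $n\in\mathbb{N}$ and a word $W=w_0\cdots w_{m-1}$, the shift is $n\oplus W=(w_0+n)\cdots(w_{m-1}+n)$. For a nonempty word $B$, $|W|_B$ is the number of (possibly overlapping) occurrences of $B$ as a factor of $W$; $c^{(k)}(B;n)=|W_n^{(k)}|_B$ and $C_B^{(k)}(y)=\sum_{n\ge0} c^{(k)}(B;n)y^n$. For $m\ge 2$, $H_m(y)=1/(1-y-y^2-\cdots-y^m)$ as a formal power series. -}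

module Defs where

open import Data.Nat using (ℕ; zero; suc; _+_; _*_; _∸_; _<_; _≤_)
open import Data.Nat.DivMod using (_%_)
open import Data.Nat.Properties using (_<?_)
open import Data.List using (List; []; _∷_; [_]; _++_; map; concatMap; length; take; drop; upTo; filter; lookup)
open import Data.List.Properties using (≡-dec)
open import Data.Fin using (Fin; toℕ)
open import Data.Product using (Σ; ∃; _×_)
open import Relation.Nullary using (does)
open import Relation.Binary.PropositionalEquality using (_≡_)
import Data.Nat as N
open import Data.Nat.ListAction using (sum)
open import Data.Bool using (if_then_else_)

Word : Set
Word = List ℕ

-- The image φ_k(a) of a single letter a = k*i + j (0 ≤ j ≤ k-1):
--   j ≤ k-2 : (k i)(k i + j + 1)    j = k-1 : (k i + k) = a + 1.
-- (k = 0 is a dummy case; the theorem assumes k ≥ 3.)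
phiLetter : ℕ → ℕ → Word
phiLetter zero    a = [ a ]
phiLetter (suc k') a =
  if does (suc (a % suc k') <? suc k')
  then (a ∸ (a % suc k')) ∷ suc a ∷ []
  else [ suc a ]

phi : ℕ → Word → Word
phi k w = concatMap (phiLetter k) w

W : ℕ → ℕ → Word
W k zero    = [ 0 ]
W k (suc n) = phi k (W k n)

shift : ℕ → Word → Word
shift n w = map (n +_) w

-- i-th letter of a word, with default 0 outside its range.
nth : Word → ℕ → ℕ
nth []       i       = 0
nth (x ∷ xs) zero    = x
nth (x ∷ xs) (suc i) = nth xs i

-- The infinite fixed point 𝐖^{(k)} = lim φ_k^n(0), as a function ℕ → ℕ:
-- its i-th letter is the i-th letter of the prefix W_{i+1}^{(k)}
-- (which has length ≥ i+2 and is a prefix of the limit).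
Winf : ℕ → ℕ → ℕ
Winf k i = nth (W k (suc i)) i

FactorInf : Word → (ℕ → ℕ) → Set
FactorInf B w = ∃ λ p → (j : Fin (length B)) → w (p + toℕ j) ≡ lookup B j

OccursAt : Word → Word → ℕ → Set
OccursAt B V p = take (length B) (drop p V) ≡ B

count : Word → Word → ℕ
count B V = length (filter (λ p → ≡-dec N._≟_ (take (length B) (drop p V)) B) (upTo (length V)))

-- c^{(k)}(B;n), i.e. the coefficient sequence of C_B^{(k)}(y).
cSeq : ℕ → Word → ℕ → ℕ
cSeq k B n = count B (W k n)

Series : Set
Series = ℕ → ℕ

_⊛_ : Series → Series → Series
(f ⊛ g) n = sum (map (λ i → f i * g (n ∸ i)) (upTo (suc n)))

monomial : ℕ → Series
monomial m n = if does (m N.≟ n) then 1 else 0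

-- Coefficients of H_m(y) = 1/(1 - y - ... - y^m): h_0 = 1,
-- h_n = h_{n-1} + ... + h_{n-m} (terms with negative index omitted).
-- Hlist m n = [h_n, h_{n-1}, ..., h_0].
Hlist : ℕ → ℕ → List ℕ
Hlist m zero    = [ 1 ]
Hlist m (suc n) = sum (take m (Hlist m n)) ∷ Hlist m n

H : ℕ → Series
H m n with Hlist m n
... | []     = 0
... | h ∷ _  = h

blocks : ℕ → ℕ → List Word
blocks k n = map (λ i → W k (n ∸ suc i)) (upTo (k ∸ 1)) ++ [ shift k (W k (n ∸ k)) ]

blockStart : ℕ → ℕ → ℕ → ℕ
blockStart k n i = sum (map length (take i (blocks k n)))

Included : ℕ → ℕ → ℕ → ℕ → Set
Included k n p ℓ = Σ (Fin (length (blocks k n))) λ i →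
  (blockStart k n (toℕ i) ≤ p) × (p + ℓ ≤ blockStart k n (toℕ i) + length (lookup (blocks k n) i))

{-# OPTIONS --safe #-}
module Submission where

-- (a) φ_k commutes with k ⊕ _ and sends k-1 to k, so W_{n+k} ends with k ⊕ W_n.  Every W_n is a
-- prefix of 𝐖, hence a factor B of 𝐖 (which lies in some W_n) reappears in 𝐖 shifted by k.
-- (b) Counting the occurrences of k ⊕ B block by block in W_n = W_{n-1} ⋯ W_{n-k+1} (k ⊕ W_{n-k})
-- gives c(k ⊕ B; n) = c(k ⊕ B; n-1) + ⋯ + c(k ⊕ B; n-k+1) + c(B; n-k) for n ≥ k, while
-- c(k ⊕ B; n) = 0 for n < k because the letters of W_n are at most n.  So C_{k⊕B} solves
-- x = y^k C_B + (y + ⋯ + y^{k-1}) x, whose only solution is y^k H_{k-1} C_B.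

open import Defs
open import Data.Bool using (true; false; if_then_else_)
open import Data.Empty using (⊥-elim)
open import Data.Fin using (Fin; toℕ; cast) renaming (zero to fzero; suc to fsuc)
open import Data.Fin.Properties using (toℕ-cast; toℕ<n)
open import Data.List using (List; []; _∷_; [_]; _++_; map; concat; take; drop; upTo; applyUpTo; filter; length; lookup)
import Data.List.Properties as List
open import Data.List.Relation.Unary.All as All using (All; []; _∷_)
open import Data.List.Relation.Unary.All.Properties using (++⁺)
open import Data.Nat using (ℕ; zero; suc; _+_; _*_; _∸_; _≤_; _<_; z≤n; s≤s; _≤?_; _<?_)
import Data.Nat as ℕ
open import Data.Nat.DivMod using (_%_; m%n≤m; m<n⇒m%n≡m; [m+n]%n≡m%n)
open import Data.Nat.Induction using (<-rec)
open import Data.Nat.ListAction using (sum)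
open import Data.Nat.ListAction.Properties using (sum-++)
open import Data.Nat.Properties
open import Algebra.Properties.CommutativeSemigroup +-commutativeSemigroup using (interchange)
open import Data.Product using (Σ; ∃; ∃₂; _,_; _×_)
open import Function using (_∘_; mk⇔)
open import Relation.Binary.PropositionalEquality hiding ([_])
open import Relation.Nullary using (Dec; does; ¬_; yes; no; contradiction)
open import Relation.Nullary.Decidable using (dec-false; does-⇔)
open import Relation.Unary using (Decidable)
open ≡-Reasoning

-- Formal power series

∑< : ℕ → (ℕ → ℕ) → ℕ
∑< n f = sum (applyUpTo f n)

infix 5 ∑<
syntax ∑< n (λ i → e) = ∑[ i < n ] e

∑-cong : ∀ n {f g : ℕ → ℕ} → (∀ i → i < n → f i ≡ g i) → ∑< n f ≡ ∑< n g
∑-cong zero    f≡g = refl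
∑-cong (suc n) f≡g = cong₂ _+_ (f≡g 0 (s≤s z≤n)) (∑-cong n (λ i i<n → f≡g (suc i) (s≤s i<n)))

∑-zero : ∀ n {f : ℕ → ℕ} → (∀ i → i < n → f i ≡ 0) → ∑< n f ≡ 0
∑-zero zero    f≡0 = refl
∑-zero (suc n) f≡0 = cong₂ _+_ (f≡0 0 (s≤s z≤n)) (∑-zero n (λ i i<n → f≡0 (suc i) (s≤s i<n)))

∑-distrib-+ : ∀ n (f g : ℕ → ℕ) → ∑[ i < n ] (f i + g i) ≡ ∑< n f + ∑< n g
∑-distrib-+ zero    f g = refl
∑-distrib-+ (suc n) f g = trans (cong (f 0 + g 0 +_) (∑-distrib-+ n (f ∘ suc) (g ∘ suc)))
                                (interchange (f 0) (g 0) _ _)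

y^_·_ : ℕ → Series → Series
(y^ zero  · f) n       = f n
(y^ suc i · f) zero    = 0
(y^ suc i · f) (suc n) = (y^ i · f) n

y^·-≤ : ∀ i f {n} → i ≤ n → (y^ i · f) n ≡ f (n ∸ i)
y^·-≤ zero    f i≤n       = refl
y^·-≤ (suc i) f (s≤s i≤n) = y^·-≤ i f i≤n

y^·-< : ∀ i f {n} → n < i → (y^ i · f) n ≡ 0
y^·-< (suc i) f {zero}  n<i       = refl
y^·-< (suc i) f {suc n} (s≤s n<i) = y^·-< i f n<i

y^·-+ : ∀ i f t → (y^ i · f) (i + t) ≡ f t
y^·-+ zero    f t = refl
y^·-+ (suc i) f t = y^·-+ i f t

y^·-cong-≤ : ∀ i {f g} n → (∀ j → j ≤ n → f j ≡ g j) → (y^ i · f) n ≡ (y^ i · g) n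
y^·-cong-≤ zero    n       f≡g = f≡g n ≤-refl
y^·-cong-≤ (suc i) zero    f≡g = refl
y^·-cong-≤ (suc i) (suc n) f≡g = y^·-cong-≤ i n (λ j j≤n → f≡g j (m≤n⇒m≤1+n j≤n))

y^·-vanishing : ∀ i {f} n → (∀ j → j ≤ n → f j ≡ 0) → (y^ i · f) n ≡ 0
y^·-vanishing zero    n       f≡0 = f≡0 n ≤-refl
y^·-vanishing (suc i) zero    f≡0 = refl
y^·-vanishing (suc i) (suc n) f≡0 = y^·-vanishing i n (λ j j≤n → f≡0 j (m≤n⇒m≤1+n j≤n))

y^·-suc-comm : ∀ i j f n → (y^ suc i · (y^ j · f)) n ≡ (y^ i · (y^ suc j · f)) n
y^·-suc-comm zero    j f zero    = refl
y^·-suc-comm zero    j f (suc n) = refl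
y^·-suc-comm (suc i) j f zero    = refl
y^·-suc-comm (suc i) j f (suc n) = y^·-suc-comm i j f n

⊛-∑ : ∀ f g n → (f ⊛ g) n ≡ ∑[ i < suc n ] f i * g (n ∸ i)
⊛-∑ f g n = cong sum (List.map-upTo (λ i → f i * g (n ∸ i)) (suc n))

⊛-congˡ : ∀ {f f′} g n → (∀ j → f j ≡ f′ j) → (f ⊛ g) n ≡ (f′ ⊛ g) n
⊛-congˡ g n f≡f′ = cong sum (List.map-cong (λ i → cong (_* g (n ∸ i)) (f≡f′ i)) (upTo (suc n)))

⊛-zeroˡ : ∀ g n → ((λ _ → 0) ⊛ g) n ≡ 0
⊛-zeroˡ g n = trans (⊛-∑ (λ _ → 0) g n) (∑-zero (suc n) (λ _ _ → refl))

⊛-identityˡ : ∀ g n → (monomial 0 ⊛ g) n ≡ g n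
⊛-identityˡ g n = begin
  (monomial 0 ⊛ g) n                                      ≡⟨ ⊛-∑ (monomial 0) g n ⟩
  1 * g n + (∑[ i < n ] monomial 0 (suc i) * g (n ∸ suc i)) ≡⟨ cong (1 * g n +_) (∑-zero n (λ _ _ → refl)) ⟩
  1 * g n + 0                                             ≡⟨ trans (+-identityʳ _) (*-identityˡ _) ⟩
  g n                                                     ∎

⊛-distribʳ-+ : ∀ f f′ g n → ((λ j → f j + f′ j) ⊛ g) n ≡ (f ⊛ g) n + (f′ ⊛ g) n
⊛-distribʳ-+ f f′ g n = begin
  ((λ j → f j + f′ j) ⊛ g) n                                      ≡⟨ ⊛-∑ (λ j → f j + f′ j) g n ⟩
  ∑[ i < suc n ] (f i + f′ i) * g (n ∸ i)                          ≡⟨ ∑-cong (suc n) (λ i _ → *-distribʳ-+ (g (n ∸ i)) (f i) (f′ i)) ⟩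
  ∑[ i < suc n ] (f i * g (n ∸ i) + f′ i * g (n ∸ i))              ≡⟨ ∑-distrib-+ (suc n) (λ i → f i * g (n ∸ i)) (λ i → f′ i * g (n ∸ i)) ⟩
  (∑[ i < suc n ] f i * g (n ∸ i)) + (∑[ i < suc n ] f′ i * g (n ∸ i)) ≡⟨ sym (cong₂ _+_ (⊛-∑ f g n) (⊛-∑ f′ g n)) ⟩
  (f ⊛ g) n + (f′ ⊛ g) n                                          ∎

⊛-distribʳ-∑ : ∀ m (F : ℕ → Series) g n → ((λ j → ∑[ i < m ] F i j) ⊛ g) n ≡ ∑[ i < m ] (F i ⊛ g) n
⊛-distribʳ-∑ zero    F g n = ⊛-zeroˡ g n
⊛-distribʳ-∑ (suc m) F g n = trans (⊛-distribʳ-+ (F 0) _ g n) (cong ((F 0 ⊛ g) n +_) (⊛-distribʳ-∑ m (F ∘ suc) g n))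

y^·-⊛ : ∀ i f g n → ((y^ i · f) ⊛ g) n ≡ (y^ i · (f ⊛ g)) n
y^·-⊛ zero    f g n       = refl
y^·-⊛ (suc i) f g zero    = refl
y^·-⊛ (suc i) f g (suc n) = begin
  ((y^ suc i · f) ⊛ g) (suc n)                          ≡⟨ ⊛-∑ (y^ suc i · f) g (suc n) ⟩
  ∑[ j < suc (suc n) ] (y^ suc i · f) j * g (suc n ∸ j) ≡⟨ sym (⊛-∑ (y^ i · f) g n) ⟩
  ((y^ i · f) ⊛ g) n                                    ≡⟨ y^·-⊛ i f g n ⟩
  (y^ i · (f ⊛ g)) n                                    ∎

monomial≡y^·monomial₀ : ∀ i n → monomial i n ≡ (y^ i · monomial 0) n
monomial≡y^·monomial₀ zero    n       = refl
monomial≡y^·monomial₀ (suc i) zero    = refl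
monomial≡y^·monomial₀ (suc i) (suc n) = monomial≡y^·monomial₀ i n

monomial-⊛ : ∀ i f n → (monomial i ⊛ f) n ≡ (y^ i · f) n
monomial-⊛ i f n = begin
  (monomial i ⊛ f) n             ≡⟨ ⊛-congˡ f n (monomial≡y^·monomial₀ i) ⟩
  ((y^ i · monomial 0) ⊛ f) n    ≡⟨ y^·-⊛ i (monomial 0) f n ⟩
  (y^ i · (monomial 0 ⊛ f)) n    ≡⟨ y^·-cong-≤ i n (λ j _ → ⊛-identityˡ f j) ⟩
  (y^ i · f) n                   ∎

Solves : ℕ → Series → Series → Set
Solves m e x = ∀ n → x n ≡ e n + (∑[ i < m ] (y^ suc i · x) n)

solves-unique : ∀ {m e x x′} → Solves m e x → Solves m e x′ → ∀ n → x n ≡ x′ n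
solves-unique {m} {e} {x} {x′} x-solves x′-solves = <-rec _ step
  where
  y^suc·-cong : ∀ i n → (∀ {j} → j < n → x j ≡ x′ j) → (y^ suc i · x) n ≡ (y^ suc i · x′) n
  y^suc·-cong i zero    _    = refl
  y^suc·-cong i (suc n) x≡x′ = y^·-cong-≤ i n (λ j j≤n → x≡x′ (s≤s j≤n))

  step : ∀ n → (∀ {j} → j < n → x j ≡ x′ j) → x n ≡ x′ n
  step n x≡x′ = begin
    x n                                 ≡⟨ x-solves n ⟩
    e n + (∑[ i < m ] (y^ suc i · x) n)  ≡⟨ cong (e n +_) (∑-cong m (λ i _ → y^suc·-cong i n x≡x′)) ⟩
    e n + (∑[ i < m ] (y^ suc i · x′) n) ≡⟨ sym (x′-solves n) ⟩
    x′ n                                ∎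

y^·-solves : ∀ j {m e x} → Solves m e x → Solves m (y^ j · e) (y^ j · x)
y^·-solves zero {m} x-solves n =
  trans (x-solves n) (cong (_ +_) (∑-cong m (λ i _ → y^·-cong-≤ (suc i) n (λ _ _ → refl))))
y^·-solves (suc j) {m} x-solves zero    = sym (∑-zero m (λ _ _ → refl))
y^·-solves (suc j) {m} {e} {x} x-solves (suc n) = begin
  (y^ j · x) n                                             ≡⟨ y^·-solves j {m} x-solves n ⟩
  (y^ j · e) n + (∑[ i < m ] (y^ suc i · (y^ j · x)) n)     ≡⟨ cong (_ +_) (∑-cong m (λ i _ → y^·-suc-comm i j x n)) ⟩
  (y^ j · e) n + (∑[ i < m ] (y^ i · (y^ suc j · x)) n)     ∎

⊛-solves : ∀ {m e x} → Solves m e x → ∀ g → Solves m (e ⊛ g) (x ⊛ g)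
⊛-solves {m} {e} {x} x-solves g n = begin
  (x ⊛ g) n                                                  ≡⟨ ⊛-congˡ g n x-solves ⟩
  ((λ j → e j + (∑[ i < m ] (y^ suc i · x) j)) ⊛ g) n         ≡⟨ ⊛-distribʳ-+ e (λ j → ∑[ i < m ] (y^ suc i · x) j) g n ⟩
  (e ⊛ g) n + ((λ j → ∑[ i < m ] (y^ suc i · x) j) ⊛ g) n     ≡⟨ cong ((e ⊛ g) n +_) (⊛-distribʳ-∑ m (λ i → y^ suc i · x) g n) ⟩
  (e ⊛ g) n + (∑[ i < m ] ((y^ suc i · x) ⊛ g) n)             ≡⟨ cong ((e ⊛ g) n +_) (∑-cong m (λ i _ → y^·-⊛ (suc i) x g n)) ⟩
  (e ⊛ g) n + (∑[ i < m ] (y^ suc i · (x ⊛ g)) n)             ∎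

Hlist-sum : ∀ m m′ n → sum (take m′ (Hlist m n)) ≡ ∑[ i < m′ ] (y^ i · H m) n
Hlist-sum m zero             n       = refl
Hlist-sum m (suc zero)       zero    = refl
Hlist-sum m (suc (suc m′))   zero    = cong (1 +_) (sym (∑-zero (suc m′) (λ _ _ → refl)))
Hlist-sum m (suc m′)         (suc n) = cong (H m (suc n) +_) (Hlist-sum m m′ n)

H-solves : ∀ m → Solves m (monomial 0) (H m)
H-solves m zero    = cong (1 +_) (sym (∑-zero m (λ _ _ → refl)))
H-solves m (suc n) = Hlist-sum m m n

H⊛-solves : ∀ m g → Solves m g (H m ⊛ g)
H⊛-solves m g n =
  trans (⊛-solves {m} (H-solves m) g n) (cong (_+ (∑[ i < m ] (y^ suc i · (H m ⊛ g)) n)) (⊛-identityˡ g n))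

-- Counting occurrences

indicator : {A : Set} → Dec A → ℕ
indicator A? = if does A? then 1 else 0

indicator-⇔ : {A A′ : Set} (A? : Dec A) (A′? : Dec A′) → (A → A′) → (A′ → A) → indicator A? ≡ indicator A′?
indicator-⇔ A? A′? to from = cong (λ b → if b then 1 else 0) (does-⇔ (mk⇔ to from) A? A′?)

indicator-¬ : {A : Set} (A? : Dec A) → ¬ A → indicator A? ≡ 0
indicator-¬ A? ¬A = cong (λ b → if b then 1 else 0) (dec-false A? ¬A)

length-filter-∷ : {P : ℕ → Set} (P? : Decidable P) → ∀ x xs →
                  length (filter P? (x ∷ xs)) ≡ indicator (P? x) + length (filter P? xs)
length-filter-∷ P? x xs with does (P? x)
... | true  = refl
... | false = refl

length-filter-map : {P : ℕ → Set} (P? : Decidable P) → ∀ (f : ℕ → ℕ) xs →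
                    length (filter P? (map f xs)) ≡ length (filter (P? ∘ f) xs)
length-filter-map P? f []       = refl
length-filter-map P? f (x ∷ xs) with does (P? (f x))
... | true  = cong suc (length-filter-map P? f xs)
... | false = length-filter-map P? f xs

prefix? : (B V : Word) → Dec (take (length B) V ≡ B)
prefix? B V = List.≡-dec ℕ._≟_ (take (length B) V) B

count-∷ : ∀ B x V → count B (x ∷ V) ≡ indicator (prefix? B (x ∷ V)) + count B V
count-∷ B x V = begin
  length (filter P? (0 ∷ applyUpTo suc (length V)))              ≡⟨ length-filter-∷ P? 0 _ ⟩
  indicator (P? 0) + length (filter P? (applyUpTo suc (length V))) ≡⟨ cong (λ xs → indicator (P? 0) + length (filter P? xs)) (sym (List.map-upTo suc (length V))) ⟩
  indicator (P? 0) + length (filter P? (map suc (upTo (length V)))) ≡⟨ cong (indicator (P? 0) +_) (length-filter-map P? suc (upTo (length V))) ⟩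
  indicator (prefix? B (x ∷ V)) + count B V                       ∎
  where
  P? : Decidable (λ p → take (length B) (drop p (x ∷ V)) ≡ B)
  P? p = prefix? B (drop p (x ∷ V))

take-++ˡ : ∀ n (u v : Word) → n ≤ length u → take n (u ++ v) ≡ take n u
take-++ˡ zero    u       v _         = refl
take-++ˡ (suc n) (x ∷ u) v (s≤s n≤u) = cong (x ∷_) (take-++ˡ n u v n≤u)

prefix-length : ∀ (B V : Word) → take (length B) V ≡ B → length B ≤ length V
prefix-length B V prefix = m⊓n≡m⇒m≤n (trans (sym (List.length-take (length B) V)) (cong length prefix))

count-++ : ∀ B u v → (∀ p → p < length u → OccursAt B (u ++ v) p → p + length B ≤ length u) →
           count B (u ++ v) ≡ count B u + count B v
count-++ B []      v _        = refl
count-++ B (x ∷ u) v inside-u = begin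
  count B (x ∷ u ++ v)                                               ≡⟨ count-∷ B x (u ++ v) ⟩
  indicator (prefix? B (x ∷ u ++ v)) + count B (u ++ v)               ≡⟨ cong₂ _+_ same-head (count-++ B u v inside-u′) ⟩
  indicator (prefix? B (x ∷ u)) + (count B u + count B v)             ≡⟨ sym (+-assoc _ (count B u) (count B v)) ⟩
  indicator (prefix? B (x ∷ u)) + count B u + count B v               ≡⟨ cong (_+ count B v) (sym (count-∷ B x u)) ⟩
  count B (x ∷ u) + count B v                                        ∎
  where
  take-B : length B ≤ length (x ∷ u) → take (length B) (x ∷ u ++ v) ≡ take (length B) (x ∷ u)
  take-B = take-++ˡ (length B) (x ∷ u) v
  same-head : indicator (prefix? B (x ∷ u ++ v)) ≡ indicator (prefix? B (x ∷ u))
  same-head = indicator-⇔ (prefix? B (x ∷ u ++ v)) (prefix? B (x ∷ u))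
    (λ prefix → trans (sym (take-B (inside-u 0 (s≤s z≤n) prefix))) prefix)
    (λ prefix → trans (take-B (prefix-length B (x ∷ u) prefix)) prefix)
  inside-u′ : ∀ p → p < length u → OccursAt B (u ++ v) p → p + length B ≤ length u
  inside-u′ p p<u occurs = ≤-pred (inside-u (suc p) (s≤s p<u) occurs)

-- Included k n is definitionally InsideABlock (blocks k n).
InsideABlock : List Word → ℕ → ℕ → Set
InsideABlock bs p ℓ = Σ (Fin (length bs)) λ i →
  (sum (map length (take (toℕ i) bs)) ≤ p) × (p + ℓ ≤ sum (map length (take (toℕ i) bs)) + length (lookup bs i))

drop-++ʳ : ∀ (u v : Word) p → drop (length u + p) (u ++ v) ≡ drop p v
drop-++ʳ []      v p = refl
drop-++ʳ (x ∷ u) v p = drop-++ʳ u v p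

count-concat : ∀ A bs → 0 < length A → (∀ p → OccursAt A (concat bs) p → InsideABlock bs p (length A)) →
               count A (concat bs) ≡ sum (map (count A) bs)
count-concat A []       _     _      = refl
count-concat A (b ∷ bs) 0<|A| inside =
  trans (count-++ A b (concat bs) inside-b) (cong (count A b +_) (count-concat A bs 0<|A| inside-bs))
  where
  inside-b : ∀ p → p < length b → OccursAt A (b ++ concat bs) p → p + length A ≤ length b
  inside-b p p<b occurs with inside p occurs
  ... | fzero  , _              , ends-in-b = ends-in-b
  ... | fsuc i , starts-after-b , _         = contradiction (≤-trans (m≤m+n (length b) _) starts-after-b) (<⇒≱ p<b)

  inside-bs : ∀ p → OccursAt A (concat bs) p → InsideABlock bs p (length A)
  inside-bs p occurs with inside (length b + p) (trans (cong (take (length A)) (drop-++ʳ b (concat bs) p)) occurs)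
  ... | fzero  , _ , ends-in-b = contradiction ends-in-b (<⇒≱ (≤-<-trans (m≤m+n (length b) p) (m<m+n (length b + p) 0<|A|)))
  ... | fsuc i , starts , ends =
    i , +-cancelˡ-≤ (length b) _ _ starts
      , +-cancelˡ-≤ (length b) _ _ (subst₂ _≤_ (+-assoc (length b) p (length A)) (+-assoc (length b) _ _) ends)

count-shift : ∀ k B V → count (shift k B) (shift k V) ≡ count B V
count-shift k B []      = refl
count-shift k B (x ∷ V) = begin
  count (shift k B) (shift k (x ∷ V))                                                ≡⟨ count-∷ (shift k B) (k + x) (shift k V) ⟩
  indicator (prefix? (shift k B) (shift k (x ∷ V))) + count (shift k B) (shift k V) ≡⟨ cong₂ _+_ same-head (count-shift k B V) ⟩
  indicator (prefix? B (x ∷ V)) + count B V                                          ≡⟨ sym (count-∷ B x V) ⟩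
  count B (x ∷ V)                                                                    ∎
  where
  take-shift : take (length (shift k B)) (shift k (x ∷ V)) ≡ shift k (take (length B) (x ∷ V))
  take-shift = trans (cong (λ n → take n (shift k (x ∷ V))) (List.length-map (k +_) B)) (List.take-map (length B) (x ∷ V))
  same-head : indicator (prefix? (shift k B) (shift k (x ∷ V))) ≡ indicator (prefix? B (x ∷ V))
  same-head = indicator-⇔ (prefix? (shift k B) (shift k (x ∷ V))) (prefix? B (x ∷ V))
    (λ prefix → List.map-injective (+-cancelˡ-≡ k _ _) (trans (sym take-shift) prefix))
    (λ prefix → trans take-shift (cong (shift k) prefix))

count-zero : ∀ a B V → All (_< a) V → count (a ∷ B) V ≡ 0
count-zero a B []      []               = refl
count-zero a B (x ∷ V) (x<a ∷ letters<a) = begin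
  count (a ∷ B) (x ∷ V)                                  ≡⟨ count-∷ (a ∷ B) x V ⟩
  indicator (prefix? (a ∷ B) (x ∷ V)) + count (a ∷ B) V   ≡⟨ cong₂ _+_ (indicator-¬ (prefix? (a ∷ B) (x ∷ V)) (<⇒≢ x<a ∘ List.∷-injectiveˡ))
                                                                      (count-zero a B V letters<a) ⟩
  0                                                      ∎

-- The morphism φ_k and the words W_n

phiLetter-shift : ∀ k a → phiLetter (suc k) (suc k + a) ≡ shift (suc k) (phiLetter (suc k) a)
phiLetter-shift k a rewrite trans (cong (_% suc k) (+-comm (suc k) a)) ([m+n]%n≡m%n a (suc k))
  with does (suc (a % suc k) <? suc k)
... | true  = cong₂ (λ x y → x ∷ y ∷ []) (+-∸-assoc (suc k) (m%n≤m a (suc k))) (sym (+-suc (suc k) a))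
... | false = cong [_] (sym (+-suc (suc k) a))

-- Once a % (k+1) is known to be a, the test `suc (a % suc k) <? suc k` of phiLetter computes to a <ᵇ k.
phiLetter-below : ∀ k j → j < k → phiLetter (suc k) j ≡ 0 ∷ suc j ∷ []
phiLetter-below k j j<k rewrite m<n⇒m%n≡m (m<n⇒m<1+n j<k) with j ℕ.<ᵇ k | <⇒<ᵇ j<k
... | true | _ = cong (_∷ suc j ∷ []) (n∸n≡0 j)

phiLetter-last : ∀ k → phiLetter (suc k) k ≡ [ suc k ]
phiLetter-last k rewrite m<n⇒m%n≡m (n<1+n k) with k ℕ.<ᵇ k | <ᵇ⇒< k k
... | true  | k<k = contradiction (k<k _) (<-irrefl refl)
... | false | _   = refl

phiLetter-≤ : ∀ k a → All (_≤ suc a) (phiLetter (suc k) a)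
phiLetter-≤ k a with does (suc (a % suc k) <? suc k)
... | true  = ≤-trans (m∸n≤m a (a % suc k)) (n≤1+n a) ∷ ≤-refl ∷ []
... | false = ≤-refl ∷ []

phiLetter-nonempty : ∀ k a → ∃₂ λ z Z → phiLetter (suc k) a ≡ z ∷ Z
phiLetter-nonempty k a with does (suc (a % suc k) <? suc k)
... | true  = _ , _ , refl
... | false = _ , _ , refl

phi-++ : ∀ k u v → phi k (u ++ v) ≡ phi k u ++ phi k v
phi-++ k = List.concatMap-++ (phiLetter k)

phi-shift : ∀ k w → phi (suc k) (shift (suc k) w) ≡ shift (suc k) (phi (suc k) w)
phi-shift k []      = refl
phi-shift k (a ∷ w) = trans (cong₂ _++_ (phiLetter-shift k a) (phi-shift k w))
                            (sym (List.map-++ (suc k +_) (phiLetter (suc k) a) (phi (suc k) w)))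

phi-letters : ∀ k {n} w → All (_≤ n) w → All (_≤ suc n) (phi (suc k) w)
phi-letters k []      []          = []
phi-letters k (a ∷ w) (a≤n ∷ w≤n) = ++⁺ (All.map (λ x≤1+a → ≤-trans x≤1+a (s≤s a≤n)) (phiLetter-≤ k a)) (phi-letters k w w≤n)

W-letters : ∀ k n → All (_≤ n) (W (suc k) n)
W-letters k zero    = z≤n ∷ []
W-letters k (suc n) = phi-letters k (W (suc k) n) (W-letters k n)

phi^ : ℕ → ℕ → Word → Word
phi^ k zero    w = w
phi^ k (suc n) w = phi k (phi^ k n w)

W≡phi^ : ∀ k n → W k n ≡ phi^ k n [ 0 ]
W≡phi^ k zero    = refl
W≡phi^ k (suc n) = cong (phi k) (W≡phi^ k n)

phi^-suc : ∀ k n w → phi^ k (suc n) w ≡ phi^ k n (phi k w)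
phi^-suc k zero    w = refl
phi^-suc k (suc n) w = cong (phi k) (phi^-suc k n w)

phi^-++ : ∀ k n u v → phi^ k n (u ++ v) ≡ phi^ k n u ++ phi^ k n v
phi^-++ k zero    u v = refl
phi^-++ k (suc n) u v = trans (cong (phi k) (phi^-++ k n u v)) (phi-++ k (phi^ k n u) (phi^ k n v))

phi^-shift : ∀ k n w → phi^ (suc k) n (shift (suc k) w) ≡ shift (suc k) (phi^ (suc k) n w)
phi^-shift k zero    w = refl
phi^-shift k (suc n) w = trans (cong (phi (suc k)) (phi^-shift k n w)) (phi-shift k (phi^ (suc k) n w))

-- φ^{d+1+r}(j) for j = k - d, unrolled d times along φ(j) = 0 (j+1) and finished by φ(k) = k+1 = (k+1) ⊕ 0.
phi^-letter : ∀ {k} d j → d + j ≡ k → ∀ r →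
  phi^ (suc k) (suc d + r) [ j ] ≡ concat (applyUpTo (λ i → W (suc k) (d + r ∸ i)) d) ++ shift (suc k) (W (suc k) r)
phi^-letter {k} zero j refl r = begin
  phi^ (suc k) (suc r) [ k ]               ≡⟨ phi^-suc (suc k) r [ k ] ⟩
  phi^ (suc k) r (phi (suc k) [ k ])       ≡⟨ cong (phi^ (suc k) r) (trans (List.++-identityʳ _) (phiLetter-last k)) ⟩
  phi^ (suc k) r [ suc k ]                 ≡⟨ cong (λ a → phi^ (suc k) r [ a ]) (sym (+-identityʳ (suc k))) ⟩
  phi^ (suc k) r (shift (suc k) [ 0 ])     ≡⟨ phi^-shift k r [ 0 ] ⟩
  shift (suc k) (phi^ (suc k) r [ 0 ])     ≡⟨ cong (shift (suc k)) (sym (W≡phi^ (suc k) r)) ⟩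
  shift (suc k) (W (suc k) r)              ∎
phi^-letter {k} (suc d) j d+j≡k r = begin
  phi^ K (suc (suc d + r)) [ j ]                         ≡⟨ phi^-suc K (suc d + r) [ j ] ⟩
  phi^ K (suc d + r) (phi K [ j ])                       ≡⟨ cong (phi^ K (suc d + r)) (trans (List.++-identityʳ _) (phiLetter-below k j j<k)) ⟩
  phi^ K (suc d + r) ([ 0 ] ++ [ suc j ])                ≡⟨ phi^-++ K (suc d + r) [ 0 ] [ suc j ] ⟩
  phi^ K (suc d + r) [ 0 ] ++ phi^ K (suc d + r) [ suc j ] ≡⟨ cong₂ _++_ (sym (W≡phi^ K (suc d + r)))
                                                                       (phi^-letter d (suc j) (trans (+-suc d j) d+j≡k) r) ⟩
  W K (suc d + r) ++ (concat (applyUpTo (λ i → W K (d + r ∸ i)) d) ++ shift K (W K r))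
                                                         ≡⟨ sym (List.++-assoc (W K (suc d + r)) _ _) ⟩
  concat (applyUpTo (λ i → W K (suc d + r ∸ i)) (suc d)) ++ shift K (W K r) ∎
  where
  K = suc k
  j<k : j < k
  j<k = ≤-trans (s≤s (m≤n+m j d)) (≤-reflexive d+j≡k)

W-split : ∀ k r → W (suc k) (suc k + r) ≡ concat (map (λ i → W (suc k) (suc k + r ∸ suc i)) (upTo k)) ++ shift (suc k) (W (suc k) r)
W-split k r = begin
  W (suc k) (suc k + r)                                                 ≡⟨ W≡phi^ (suc k) (suc k + r) ⟩
  phi^ (suc k) (suc k + r) [ 0 ]                                        ≡⟨ phi^-letter k 0 (+-identityʳ k) r ⟩
  concat (applyUpTo (λ i → W (suc k) (k + r ∸ i)) k) ++ shift (suc k) (W (suc k) r)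
                                                                        ≡⟨ cong (λ bs → concat bs ++ shift (suc k) (W (suc k) r))
                                                                                (sym (List.map-upTo (λ i → W (suc k) (k + r ∸ i)) k)) ⟩
  concat (map (λ i → W (suc k) (suc k + r ∸ suc i)) (upTo k)) ++ shift (suc k) (W (suc k) r) ∎

W-blocks : ∀ k r → W (suc k) (suc k + r) ≡ concat (blocks (suc k) (suc k + r))
W-blocks k r = begin
  W K (K + r)                                          ≡⟨ W-split k r ⟩
  concat first ++ shift K (W K r)                      ≡⟨ cong (λ n → concat first ++ shift K (W K n)) (sym (m+n∸m≡n K r)) ⟩
  concat first ++ shift K (W K (K + r ∸ K))            ≡⟨ cong (concat first ++_) (sym (List.++-identityʳ _)) ⟩
  concat first ++ concat [ shift K (W K (K + r ∸ K)) ] ≡⟨ List.concat-++ first _ ⟩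
  concat (blocks K (K + r))                            ∎
  where
  K = suc k
  first = map (λ i → W K (K + r ∸ suc i)) (upTo k)

W-step : ∀ k n → ∃₂ λ z Z → W (suc (suc k)) (suc n) ≡ W (suc (suc k)) n ++ z ∷ Z
W-step k zero = 1 , [] , refl
W-step k (suc n) with W-step k n
... | z , Z , step with phiLetter-nonempty (suc k) z
...   | z′ , Z′ , φz≡ = z′ , Z′ ++ phi K Z , (begin
  phi K (W K (suc n))                     ≡⟨ cong (phi K) step ⟩
  phi K (W K n ++ z ∷ Z)                  ≡⟨ phi-++ K (W K n) (z ∷ Z) ⟩
  W K (suc n) ++ phiLetter K z ++ phi K Z ≡⟨ cong (λ u → W K (suc n) ++ u ++ phi K Z) φz≡ ⟩
  W K (suc n) ++ z′ ∷ Z′ ++ phi K Z       ∎)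
  where K = suc (suc k)

W-prefix : ∀ k d n → ∃ λ Z → W (suc (suc k)) (d + n) ≡ W (suc (suc k)) n ++ Z
W-prefix k zero    n = [] , sym (List.++-identityʳ _)
W-prefix k (suc d) n with W-prefix k d n | W-step k (d + n)
... | Z , prefix | z , Z′ , step = Z ++ z ∷ Z′ , trans step (trans (cong (_++ z ∷ Z′) prefix) (List.++-assoc _ Z (z ∷ Z′)))

W-length : ∀ k n → n < length (W (suc (suc k)) n)
W-length k zero    = s≤s z≤n
W-length k (suc n) with W-step k n
... | z , Z , step = subst (λ V → suc n < length V) (sym step)
  (subst (suc n <_) (sym (List.length-++-sucʳ (W (suc (suc k)) n) z Z))
         (s≤s (≤-trans (W-length k n) (List.length-++-≤ˡ (W (suc (suc k)) n)))))

nth-++ˡ : ∀ (u v : Word) {i} → i < length u → nth (u ++ v) i ≡ nth u i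
nth-++ˡ (x ∷ u) v {zero}  _         = refl
nth-++ˡ (x ∷ u) v {suc i} (s≤s i<u) = nth-++ˡ u v i<u

nth-++ʳ : ∀ (u v : Word) i → nth (u ++ v) (length u + i) ≡ nth v i
nth-++ʳ []      v i = refl
nth-++ʳ (x ∷ u) v i = nth-++ʳ u v i

nth-map : ∀ f (V : Word) {i} → i < length V → nth (map f V) i ≡ f (nth V i)
nth-map f (x ∷ V) {zero}  _         = refl
nth-map f (x ∷ V) {suc i} (s≤s i<V) = nth-map f V i<V

Winf-nth : ∀ k n {i} → i < length (W (suc (suc k)) n) → Winf (suc (suc k)) i ≡ nth (W (suc (suc k)) n) i
Winf-nth k n {i} i<Wn with W-prefix k n (suc i) | W-prefix k (suc i) n
... | Z , prefix | Z′ , prefix′ = begin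
  nth (W K (suc i)) i          ≡⟨ sym (nth-++ˡ (W K (suc i)) Z (<-trans (n<1+n i) (W-length k (suc i)))) ⟩
  nth (W K (suc i) ++ Z) i     ≡⟨ cong (λ V → nth V i) (sym prefix) ⟩
  nth (W K (n + suc i)) i      ≡⟨ cong (λ m → nth (W K m) i) (+-comm n (suc i)) ⟩
  nth (W K (suc i + n)) i      ≡⟨ cong (λ V → nth V i) prefix′ ⟩
  nth (W K n ++ Z′) i          ≡⟨ nth-++ˡ (W K n) Z′ i<Wn ⟩
  nth (W K n) i                ∎
  where K = suc (suc k)

Winf-shifted-copy : ∀ k N → ∃ λ q → ∀ {i} → i < length (W (suc (suc k)) N) → Winf (suc (suc k)) (q + i) ≡ suc (suc k) + Winf (suc (suc k)) i
Winf-shifted-copy k N = length X , λ {i} i<WN → begin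
  Winf K (length X + i)                  ≡⟨ Winf-nth k (K + N) (subst (λ V → length X + i < length V) (sym split) (X++WN-bound i<WN)) ⟩
  nth (W K (K + N)) (length X + i)       ≡⟨ cong (λ V → nth V (length X + i)) split ⟩
  nth (X ++ shift K (W K N)) (length X + i) ≡⟨ nth-++ʳ X (shift K (W K N)) i ⟩
  nth (shift K (W K N)) i                ≡⟨ nth-map (K +_) (W K N) i<WN ⟩
  K + nth (W K N) i                      ≡⟨ cong (K +_) (sym (Winf-nth k N i<WN)) ⟩
  K + Winf K i                           ∎
  where
  K = suc (suc k)
  X = concat (map (λ i → W K (K + N ∸ suc i)) (upTo (suc k)))
  split : W K (K + N) ≡ X ++ shift K (W K N)
  split = W-split (suc k) N
  X++WN-bound : ∀ {i} → i < length (W K N) → length X + i < length (X ++ shift K (W K N))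
  X++WN-bound {i} i<WN = subst (length X + i <_) (sym (trans (List.length-++ X) (cong (length X +_) (List.length-map (K +_) (W K N)))))
                           (+-monoʳ-< (length X) i<WN)

lookup-map : ∀ (f : ℕ → ℕ) xs (i : Fin (length (map f xs))) → lookup (map f xs) i ≡ f (lookup xs (cast (List.length-map f xs) i))
lookup-map f (x ∷ xs) fzero    = refl
lookup-map f (x ∷ xs) (fsuc i) = lookup-map f xs i

factor-shift : ∀ k B → FactorInf B (Winf (suc (suc k))) → FactorInf (shift (suc (suc k)) B) (Winf (suc (suc k)))
factor-shift k B (p , occurs) with Winf-shifted-copy k (p + length B)
... | q , copy = q + p , λ j → let j′ = cast (List.length-map (K +_) B) j in begin
  Winf K (q + p + toℕ j)     ≡⟨ cong (Winf K) (trans (+-assoc q p (toℕ j)) (cong (λ i → q + (p + i)) (sym (toℕ-cast _ j)))) ⟩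
  Winf K (q + (p + toℕ j′))  ≡⟨ copy (<-trans (+-monoʳ-< p (toℕ<n j′)) (W-length k (p + length B))) ⟩
  K + Winf K (p + toℕ j′)    ≡⟨ cong (K +_) (occurs j′) ⟩
  K + lookup B j′            ≡⟨ sym (lookup-map (K +_) B j) ⟩
  lookup (shift K B) j       ∎
  where K = suc (suc k)

-- The recurrence for c(k ⊕ B; n)

sum-map-blocks : ∀ k n (f : Word → ℕ) →
  sum (map f (blocks (suc k) n)) ≡ (∑[ i < k ] f (W (suc k) (n ∸ suc i))) + f (shift (suc k) (W (suc k) (n ∸ suc k)))
sum-map-blocks k n f = begin
  sum (map f (first ++ [ last ]))           ≡⟨ cong sum (List.map-++ f first [ last ]) ⟩
  sum (map f first ++ [ f last ])           ≡⟨ sum-++ (map f first) [ f last ] ⟩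
  sum (map f first) + (f last + 0)          ≡⟨ cong₂ _+_ (cong sum (trans (sym (List.map-∘ (upTo k))) (List.map-upTo _ k)))
                                                         (+-identityʳ (f last)) ⟩
  (∑[ i < k ] f (W (suc k) (n ∸ suc i))) + f last ∎
  where
  first = map (λ i → W (suc k) (n ∸ suc i)) (upTo k)
  last  = shift (suc k) (W (suc k) (n ∸ suc k))

cSeq-shift-step : ∀ k B t → 0 < length B →
  (∀ p → OccursAt (shift (suc k) B) (W (suc k) (suc k + t)) p → Included (suc k) (suc k + t) p (length B)) →
  cSeq (suc k) (shift (suc k) B) (suc k + t) ≡ (∑[ i < k ] cSeq (suc k) (shift (suc k) B) (k + t ∸ i)) + cSeq (suc k) B t
cSeq-shift-step k B t 0<|B| included = begin
  count A (W K (K + t))                                        ≡⟨ cong (count A) (W-blocks k t) ⟩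
  count A (concat (blocks K (K + t)))                          ≡⟨ count-concat A (blocks K (K + t)) 0<|A| inside ⟩
  sum (map (count A) (blocks K (K + t)))                       ≡⟨ sum-map-blocks k (K + t) (count A) ⟩
  (∑[ i < k ] count A (W K (k + t ∸ i))) + count A (shift K (W K (K + t ∸ K)))
                                                               ≡⟨ cong ((∑[ i < k ] count A (W K (k + t ∸ i))) +_) (count-shift K B (W K (K + t ∸ K))) ⟩
  (∑[ i < k ] count A (W K (k + t ∸ i))) + count B (W K (K + t ∸ K))
                                                               ≡⟨ cong (λ n → (∑[ i < k ] count A (W K (k + t ∸ i))) + count B (W K n)) (m+n∸m≡n K t) ⟩
  (∑[ i < k ] count A (W K (k + t ∸ i))) + count B (W K t)      ∎
  where
  K = suc k
  A = shift K B
  0<|A| : 0 < length A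
  0<|A| = subst (0 <_) (sym (List.length-map (K +_) B)) 0<|B|
  inside : ∀ p → OccursAt A (concat (blocks K (K + t))) p → InsideABlock (blocks K (K + t)) p (length A)
  inside p occurs = subst (InsideABlock (blocks K (K + t)) p) (sym (List.length-map (K +_) B))
                          (included p (subst (λ V → OccursAt A V p) (sym (W-blocks k t)) occurs))

cSeq-shift-solves : ∀ k b B →
  (∀ n → suc k ≤ n → ∀ p → OccursAt (shift (suc k) (b ∷ B)) (W (suc k) n) p → Included (suc k) n p (length (b ∷ B))) →
  Solves k (y^ suc k · cSeq (suc k) (b ∷ B)) (cSeq (suc k) (shift (suc k) (b ∷ B)))
cSeq-shift-solves k b B included n with suc k ≤? n
... | no K≰n = begin
  C n                                                   ≡⟨ C-below-K n<K ⟩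
  0                                                     ≡⟨ sym (cong₂ _+_ (y^·-< K c n<K) (∑-zero k (λ i _ → y^·-vanishing (suc i) n C-below-n))) ⟩
  (y^ K · c) n + (∑[ i < k ] (y^ suc i · C) n)           ∎
  where
  K = suc k
  c = cSeq K (b ∷ B)
  C = cSeq K (shift K (b ∷ B))
  n<K = ≰⇒> K≰n
  C-below-K : ∀ {j} → j < K → C j ≡ 0
  C-below-K {j} j<K = count-zero (K + b) (shift K B) (W K j)
                        (All.map (λ x≤j → ≤-<-trans x≤j (≤-trans j<K (m≤m+n K b))) (W-letters k j))
  C-below-n : ∀ j → j ≤ n → C j ≡ 0
  C-below-n j j≤n = C-below-K (≤-<-trans j≤n n<K)
... | yes K≤n with m≤n⇒∃[o]m+o≡n K≤n
...   | t , refl = begin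
  C (K + t)                                             ≡⟨ cSeq-shift-step k (b ∷ B) t (s≤s z≤n) (included (K + t) K≤n) ⟩
  (∑[ i < k ] C (k + t ∸ i)) + c t                      ≡⟨ +-comm _ (c t) ⟩
  c t + (∑[ i < k ] C (k + t ∸ i))                      ≡⟨ cong₂ _+_ (sym (y^·-+ K c t))
                                                                   (∑-cong k (λ i i<k → sym (y^·-≤ i C (≤-trans (<⇒≤ i<k) (m≤m+n k t))))) ⟩
  (y^ K · c) (K + t) + (∑[ i < k ] (y^ suc i · C) (K + t)) ∎
  where
  K = suc k
  c = cSeq K (b ∷ B)
  C = cSeq K (shift K (b ∷ B))

theorem3p1 : (k : ℕ) → 3 ≤ k → (B : List ℕ) → B ≢ [] → FactorInf B (Winf k) →
    FactorInf (shift k B) (Winf k)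
    × (((n : ℕ) → k ≤ n → (p : ℕ) → OccursAt (shift k B) (W k n) p → Included k n p (length B)) →
       (n : ℕ) → cSeq k (shift k B) n ≡ ((monomial k ⊛ H (k ∸ 1)) ⊛ cSeq k B) n)
theorem3p1 (suc (suc (suc k))) (s≤s (s≤s (s≤s z≤n))) []      B≢[] _      = ⊥-elim (B≢[] refl)
theorem3p1 K@(suc k′@(suc (suc k))) (s≤s (s≤s (s≤s z≤n))) (b ∷ B) _ factor =
  factor-shift (suc k) (b ∷ B) factor , λ included n → begin
    cSeq K (shift K (b ∷ B)) n       ≡⟨ solves-unique {k′} {y^ K · c} (cSeq-shift-solves k′ b B included) (y^·-solves K {k′} (H⊛-solves k′ c)) n ⟩
    (y^ K · (H k′ ⊛ c)) n            ≡⟨ sym (y^·-⊛ K (H k′) c n) ⟩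
    ((y^ K · H k′) ⊛ c) n            ≡⟨ ⊛-congˡ c n (λ j → sym (monomial-⊛ K (H k′) j)) ⟩
    ((monomial K ⊛ H k′) ⊛ c) n      ∎
  where
  c = cSeq K (b ∷ B)
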